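{- Let $A$ be a set with decidable equality and let $s\colon M(A)\to L(A)$ be a section of $q$ satisfying is-head-least and is-tail-sort. Then $\le_s$ is a decidable total order on $A$, and the insertion sort function $t_{\le_s}\colon M(A)\to L(A)$ parameterised by $\le_s$ is equal to $s$.
   Context: Univalent type theory. $L(A)$ is the free monoid on $A$ (finite lists, $x::xs$ prepending), $M(A)$ the free commutative monoid (finite multisets) with generators $\eta_A$, $\langle x,y\rangle=\eta_A(x)\cdot\eta_A(y)$, $q$ the monoid homomorphism $L(A)\to M(A)$ extending $\eta_A$; a section is $s$ with $q\circ s=\mathrm{id}$. $\mathrm{head}\colon L(A)\to1+A$ returns $\mathrm{inl}(\ast)$ on $[]$ and $\mathrm{inr}(x)$ on $x::xs$; $x\le_s y$ means $\mathrm{head}(s(\langle x,y\rangle))=\mathrm{inr}(x)$. $xs\in\mathrm{im}(s)$ means there merely exists $ys$ with $s(ys)=xs$; $y\in xs$ means $y$ equals some entry of $xs$. is-head-least: for all $x,y,xs$, $y\in x::xs$ and $x::xs\in\mathrm{im}(s)$ imply $[x,y]\in\mathrm{im}(s)$. is-tail-sort: $x::xs\in\mathrm{im}(s)$ implies $xs\in\mathrm{im}(s)$. A decidable total order is a proposition-valued reflexive, transitive, antisymmetric, total relation $\le$ with $(x\le y)+\neg(x\le y)$ for all $x,y$. Insertion sort by $\le$: $\mathrm{insert}(x,[])=[x]$, $\mathrm{insert}(x,y::ys)=x::y::ys$ if $x\le y$ and $y::\mathrm{insert}(x,ys)$ otherwise; it induces a section $M(A)\to L(A)$ sending $\eta_A(x_1)\cdots\eta_A(x_n)$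 to $\mathrm{insert}(x_1,\mathrm{insert}(x_2,\dots\mathrm{insert}(x_n,[])))$. -}

module Defs where

open import Level using (Level)
open import Data.List using (List; []; _∷_; foldr)
open import Data.Sum using (_⊎_; inj₁; inj₂)
open import Data.Unit using (⊤; tt)
open import Data.Product using (Σ; _×_; _,_)
open import Relation.Nullary using (Dec; yes; no)
open import Relation.Binary.Core using (Rel)
open import Relation.Binary.Definitions using (Decidable)
open import Relation.Binary.PropositionalEquality using (_≡_)
open import Relation.Binary.Structures using (IsDecTotalOrder)
open import Data.List.Membership.Propositional using (_∈_)
open import Data.List.Relation.Binary.Permutation.Propositional using (_↭_)

-- L(A) is List A.  M(A), the free commutative monoid on A, is modelled as
-- the setoid (List A, _↭_): a multiset is represented by any list of its
-- elements, and q : L(A) → M(A) sends a list to its class (identity on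
-- representatives).  A function M(A) → L(A) is a function on lists that
-- respects _↭_, and equality in M(A) is _↭_.

record Section {a : Level} (A : Set a) : Set a where
  field
    s       : List A → List A
    s-resp  : ∀ {xs ys} → xs ↭ ys → s xs ≡ s ys   -- well-defined on M(A)
    s-sec   : ∀ xs → s xs ↭ xs                   -- q ∘ s = id

module _ {a : Level} {A : Set a} where

  -- ⟨ x , y ⟩ = η x · η y  (representative of the multiset {x, y})
  ⟨_,_⟩ : A → A → List A
  ⟨ x , y ⟩ = x ∷ y ∷ []

  head : List A → ⊤ ⊎ A
  head []       = inj₁ tt
  head (x ∷ _)  = inj₂ x

  InIm : (List A → List A) → List A → Set a
  InIm s xs = Σ (List A) λ ys → s ys ≡ xs

  _≤[_]_ : A → (List A → List A) → A → Set a
  x ≤[ s ] y = head (s ⟨ x , y ⟩) ≡ inj₂ x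

  is-head-least : (List A → List A) → Set a
  is-head-least s = ∀ x y xs → y ∈ (x ∷ xs) → InIm s (x ∷ xs) → InIm s (x ∷ y ∷ [])

  is-tail-sort : (List A → List A) → Set a
  is-tail-sort s = ∀ x xs → InIm s (x ∷ xs) → InIm s xs

  module _ {ℓ : Level} {_≤_ : Rel A ℓ} (_≤?_ : Decidable _≤_) where

    insert : A → List A → List A
    insert x []       = x ∷ []
    insert x (y ∷ ys) with x ≤? y
    ... | yes _ = x ∷ y ∷ ys
    ... | no  _ = y ∷ insert x ys

    insertionSort : List A → List A
    insertionSort = foldr insert []

  IsPropValued : ∀ {ℓ} → Rel A ℓ → Set _
  IsPropValued _≤_ = ∀ {x y} (p q : x ≤ y) → p ≡ q

-- The order x ≤ₛ y reads off which of x, y the section puts first in the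
-- two-element multiset {x, y}.  Since s(xs) is a permutation of xs and s
-- only depends on the multiset, ≤ₛ is reflexive, total and antisymmetric.
-- Head-leastness says the head of a list in the image of s is ≤ₛ-below
-- all its entries, which gives transitivity (look at the head of s{x, y, z}), and
-- together with tail-sortedness it makes every list in the image of s
-- sorted.  Insertion sort by ≤ₛ also produces a sorted permutation, and a
-- sorted permutation of a list is unique for an antisymmetric order.
module Submission where

open import Defs
open import Level using (Level)
open import Data.List using (List; []; _∷_)
open import Data.Product using (Σ; _×_; _,_)
open import Data.Sum using (_⊎_; inj₁; inj₂)
open import Data.Unit using (⊤)
import Data.Unit.Properties as ⊤
import Data.Sum.Properties as ⊎
open import Relation.Nullary using (yes; no)
open import Relation.Binary.Core using (Rel)
open import Relation.Binary.Definitions using (DecidableEquality; Decidable; Reflexive; Transitive; Total; Antisymmetric)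
open import Relation.Binary.PropositionalEquality using (_≡_; refl; sym; trans; cong; subst; isEquivalence; module ≡-Reasoning)
open import Relation.Binary.Structures using (IsDecTotalOrder; IsTotalOrder)
open import Relation.Binary.Bundles using (TotalOrder; DecTotalOrder)
open import Axiom.UniquenessOfIdentityProofs using (module Decidable⇒UIP)
open import Data.List.Membership.Propositional using (_∈_)
open import Data.List.Relation.Unary.Any using (here; there)
open import Data.List.Relation.Unary.Linked using (Linked; []; [-]; _∷_)
open import Data.List.Relation.Unary.Sorted.TotalOrder using (Sorted)
open import Data.List.Relation.Unary.Sorted.TotalOrder.Properties using (↗↭↗⇒≋)
open import Data.List.Relation.Binary.Pointwise using (Pointwise-≡⇒≡)
open import Data.List.Relation.Binary.Permutation.Propositional using (_↭_; ↭-sym; ↭-trans; ↭-refl; swap; ↭⇒↭ₛ′)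
open import Data.List.Relation.Binary.Permutation.Propositional.Properties using (∈-resp-↭; ↭-singleton-inv; drop-∷; ↭-length)
import Data.List.Sort.InsertionSort as InsertionSort
import Data.List.Sort.InsertionSort.Properties as InsertionSortProperties

private
  variable
    a ℓ₁ ℓ₂ : Level

↭-pair-inv : {A : Set a} {xs : List A} {x y : A} →
             xs ↭ x ∷ y ∷ [] → xs ≡ x ∷ y ∷ [] ⊎ xs ≡ y ∷ x ∷ []
↭-pair-inv {xs = []}             p with () ← ↭-length p
↭-pair-inv {xs = _ ∷ []}         p with () ← ↭-length p
↭-pair-inv {xs = _ ∷ _ ∷ _ ∷ _}  p with () ← ↭-length p
↭-pair-inv {xs = u ∷ _ ∷ []} {x} p with ∈-resp-↭ p (here refl)
... | here refl with refl ← ↭-singleton-inv (drop-∷ p) = inj₁ refl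
... | there (here refl)
  with refl ← ↭-singleton-inv (drop-∷ (↭-trans p (swap x u ↭-refl))) = inj₂ refl

module _ {A : Set a} {_≤_ : Rel A ℓ₂} (isTotalOrder : IsTotalOrder _≡_ _≤_) where

  private
    O : TotalOrder a a ℓ₂
    O = record { isTotalOrder = isTotalOrder }

  ↗↭↗⇒≡ : {xs ys : List A} → Sorted O xs → Sorted O ys → xs ↭ ys → xs ≡ ys
  ↗↭↗⇒≡ xs↗ ys↗ xs↭ys = Pointwise-≡⇒≡ (↗↭↗⇒≋ O xs↗ ys↗ (↭⇒↭ₛ′ isEquivalence xs↭ys))

module _ (O : DecTotalOrder a ℓ₁ ℓ₂) where
  open DecTotalOrder O using (_≤?_)
  open InsertionSort O using (sort)

  insert≗InsertionSort-insert : ∀ x ys → insert _≤?_ x ys ≡ InsertionSort.insert O x ys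
  insert≗InsertionSort-insert x []       = refl
  insert≗InsertionSort-insert x (y ∷ ys) with x ≤? y
  ... | yes _ = refl
  ... | no  _ = cong (y ∷_) (insert≗InsertionSort-insert x ys)

  insertionSort≗sort : ∀ xs → insertionSort _≤?_ xs ≡ sort xs
  insertionSort≗sort []       = refl
  insertionSort≗sort (x ∷ xs) = trans (insert≗InsertionSort-insert x (insertionSort _≤?_ xs))
                                      (cong (InsertionSort.insert O x) (insertionSort≗sort xs))

module _ {A : Set a} (sec : Section A) where
  open Section sec

  _≤ₛ_ : Rel A a
  x ≤ₛ y = x ≤[ s ] y

  s∘s≡s : ∀ {xs} → InIm s xs → s xs ≡ xs
  s∘s≡s (ys , refl) = s-resp (s-sec ys)

  InIm⇒≤ₛ : ∀ {x y} → InIm s (x ∷ y ∷ []) → x ≤ₛ y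
  InIm⇒≤ₛ im = cong head (s∘s≡s im)

  s-swap : ∀ x y → s ⟨ x , y ⟩ ≡ s ⟨ y , x ⟩
  s-swap x y = s-resp (swap x y ↭-refl)

  ≤ₛ-refl : Reflexive _≤ₛ_
  ≤ₛ-refl {x} with ↭-pair-inv (s-sec ⟨ x , x ⟩)
  ... | inj₁ eq = cong head eq
  ... | inj₂ eq = cong head eq

  ≤ₛ-total : Total _≤ₛ_
  ≤ₛ-total x y with ↭-pair-inv (s-sec ⟨ x , y ⟩)
  ... | inj₁ eq = inj₁ (cong head eq)
  ... | inj₂ eq = inj₂ (cong head (trans (s-swap y x) eq))

  ≤ₛ-antisym : Antisymmetric _≡_ _≤ₛ_
  ≤ₛ-antisym {x} {y} x≤y y≤x = ⊎.inj₂-injective (begin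
    inj₂ x              ≡⟨ sym x≤y ⟩
    head (s ⟨ x , y ⟩)  ≡⟨ cong head (s-swap x y) ⟩
    head (s ⟨ y , x ⟩)  ≡⟨ y≤x ⟩
    inj₂ y              ∎)
    where open ≡-Reasoning

  module _ (_≟_ : DecidableEquality A) where

    private
      _≟ₕ_ : DecidableEquality (⊤ ⊎ A)
      _≟ₕ_ = ⊎.≡-dec ⊤._≟_ _≟_

    ≤ₛ-irrelevant : IsPropValued _≤ₛ_
    ≤ₛ-irrelevant = Decidable⇒UIP.≡-irrelevant _≟ₕ_

    _≤ₛ?_ : Decidable _≤ₛ_
    x ≤ₛ? y = head (s ⟨ x , y ⟩) ≟ₕ inj₂ x

  module _ (head-least : is-head-least s) where

    head-≤ₛ : ∀ {x y xs} → InIm s (x ∷ xs) → y ∈ x ∷ xs → x ≤ₛ y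
    head-≤ₛ im y∈ = InIm⇒≤ₛ (head-least _ _ _ y∈ im)

    least-entry : ∀ x xs → Σ A λ m → m ∈ x ∷ xs × (∀ {w} → w ∈ x ∷ xs → m ≤ₛ w)
    least-entry x xs with s (x ∷ xs) in eq | s-sec (x ∷ xs)
    ... | []    | s↭ with () ← ↭-length s↭
    ... | m ∷ _ | s↭ = m , ∈-resp-↭ s↭ (here refl)
                     , λ w∈ → head-≤ₛ (x ∷ xs , eq) (∈-resp-↭ (↭-sym s↭) w∈)

    ≤ₛ-trans : Transitive _≤ₛ_
    ≤ₛ-trans {x} {y} {z} x≤y y≤z with least-entry x (y ∷ z ∷ [])
    ... | _ , here refl , m≤ = m≤ (there (there (here refl)))
    ... | _ , there (here refl) , m≤ = subst (_≤ₛ z) (≤ₛ-antisym (m≤ (here refl)) x≤y) y≤z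
    ... | _ , there (there (here refl)) , m≤ = subst (x ≤ₛ_) (≤ₛ-antisym y≤z (m≤ (there (here refl)))) x≤y

    ≤ₛ-isTotalOrder : IsTotalOrder _≡_ _≤ₛ_
    ≤ₛ-isTotalOrder = record
      { isPartialOrder = record
        { isPreorder = record
          { isEquivalence = isEquivalence
          ; reflexive     = λ { refl → ≤ₛ-refl }
          ; trans         = ≤ₛ-trans
          }
        ; antisym = ≤ₛ-antisym
        }
      ; total = ≤ₛ-total
      }

    ≤ₛ-isDecTotalOrder : DecidableEquality A → IsDecTotalOrder _≡_ _≤ₛ_
    ≤ₛ-isDecTotalOrder _≟_ = record
      { isTotalOrder = ≤ₛ-isTotalOrder
      ; _≟_          = _≟_
      ; _≤?_         = _≤ₛ?_ _≟_
      }

    image-sorted : is-tail-sort s → ∀ {xs} → InIm s xs → Linked _≤ₛ_ xs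
    image-sorted tail-sort {[]}          _  = []
    image-sorted tail-sort {_ ∷ []}      _  = [-]
    image-sorted tail-sort {x ∷ y ∷ xs} im =
      head-≤ₛ im (there (here refl)) ∷ image-sorted tail-sort (tail-sort x (y ∷ xs) im)

lemma69 : ∀ {a} {A : Set a} → DecidableEquality A → (sec : Section A)
          → is-head-least (Section.s sec) → is-tail-sort (Section.s sec)
          → Σ (IsDecTotalOrder _≡_ (λ x y → x ≤[ Section.s sec ] y)) λ dto
              → IsPropValued (λ x y → x ≤[ Section.s sec ] y)
                × (∀ xs → insertionSort (IsDecTotalOrder._≤?_ dto) xs ≡ Section.s sec xs)
lemma69 _≟_ sec head-least tail-sort = ≤ₛ-isDecTotalOrder sec head-least _≟_ , ≤ₛ-irrelevant sec _≟_ , insertionSort≡s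
  where
  open Section sec

  O : DecTotalOrder _ _ _
  O = record { isDecTotalOrder = ≤ₛ-isDecTotalOrder sec head-least _≟_ }

  open InsertionSort O using (sort)
  open InsertionSortProperties O using (sort-↗; sort-↭)

  insertionSort≡s : ∀ xs → insertionSort (_≤ₛ?_ sec _≟_) xs ≡ s xs
  insertionSort≡s xs = begin
    insertionSort (_≤ₛ?_ sec _≟_) xs  ≡⟨ insertionSort≗sort O xs ⟩
    sort xs                           ≡⟨ ↗↭↗⇒≡ (≤ₛ-isTotalOrder sec head-least)
                                                (sort-↗ xs)
                                                (image-sorted sec head-least tail-sort (xs , refl))
                                                (↭-trans (sort-↭ xs) (↭-sym (s-sec xs))) ⟩
    s xs                              ∎
    where open ≡-Reasoning
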